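{- Let $A$ be a finite set and $(Y_a)_{a\in A}$ an indexed family of non-empty finite subsets of $\mathbb{Z}$. If the intersection graph of $(Y_a)_{a\in A}$ is disconnected, then there exists $(u_a)_{a\in A}\in\mathbb{Z}^A$ such that $$\left|\bigcup_{a\in A}(Y_a+u_a)\right| < \left|\bigcup_{a\in A}Y_a\right|.$$
   Context: The intersection graph of $(Y_a)_{a\in A}$ is the graph with vertex set $A$ in which, for distinct $b,c\in A$, $\{b,c\}$ is an edge if and only if $Y_b\cap Y_c\neq\emptyset$. A graph $(V,E)$ is disconnected if there is a pair $(B,C)$ of non-empty disjoint sets with $V=B\cup C$ and $\{b,c\}\notin E$ for all $b\in B$, $c\in C$. Here $Y+u=\{y+u: y\in Y\}$. -}

module Defs where

open import Data.Nat using (ℕ)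
open import Data.Integer using (ℤ; _+_; _≟_)
open import Data.Fin using (Fin)
open import Data.List using (List; []; length; map; deduplicate; concatMap; allFin)
open import Data.List.Membership.Propositional using (_∈_)
open import Data.Product using (Σ; ∃; _×_)
open import Data.Sum using (_⊎_)
open import Relation.Binary.PropositionalEquality using (_≡_; _≢_)
open import Relation.Nullary using (¬_)

-- Finite subsets of ℤ are represented by lists (duplicates allowed; the set is
-- the set of list members).  Cardinality = number of distinct members.
card : List ℤ → ℕ
card xs = length (deduplicate _≟_ xs)

_⊕_ : List ℤ → ℤ → List ℤ
Y ⊕ u = map (λ y → y + u) Y

⋃ : ∀ {n} → (Fin n → List ℤ) → List ℤ
⋃ {n} Y = concatMap Y (allFin n)

Edge : ∀ {n} → (Fin n → List ℤ) → Fin n → Fin n → Set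
Edge Y b c = b ≢ c × ∃ λ x → x ∈ Y b × x ∈ Y c

IntersectionGraphDisconnected : ∀ {n} → (Fin n → List ℤ) → Set₁
IntersectionGraphDisconnected {n} Y =
  Σ (Fin n → Set) λ B → Σ (Fin n → Set) λ C →
    (∃ λ b → B b) × (∃ λ c → C c) ×
    (∀ a → B a → ¬ C a) ×
    (∀ a → B a ⊎ C a) ×
    (∀ b c → B b → C c → ¬ Edge Y b c)

module Submission where

-- Let B ⊔ C be a disconnection of the intersection graph, pick
-- x ∈ Y_b (b ∈ B) and y ∈ Y_c (c ∈ C), and translate every Y_a with a ∈ C
-- by t = x - y while leaving the sets indexed by B in place.  Put
-- U_B = ⋃_{a∈B} Y_a and let  fold v = v  if v ∈ U_B,  fold v = v + t  otherwise.
-- Because no set indexed by C meets U_B, every element of the new union is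
-- fold v for some v in the old union; and fold identifies the two distinct
-- old elements x and y (both are sent to x).  A map that identifies two
-- points of a finite set has a strictly smaller image, so the union shrinks.

open import Defs
open import Data.Nat using (ℕ; suc; _≤_; _<_; z≤n; s≤s)
open import Data.Nat.Properties using (≤-refl; ≤-<-trans; module ≤-Reasoning)
open import Data.Integer using (ℤ; 0ℤ; _+_; _-_; _≟_)
open import Data.Integer.Properties using (+-identityʳ)
open import Data.Integer.Tactic.RingSolver using (solve-∀)
open import Data.Fin using (Fin)
open import Data.List using (List; []; _∷_; _++_; length; map; filter; concatMap; allFin; deduplicate)
open import Data.List.Properties using (length-map; length-++-sucʳ)
open import Data.List.Membership.Propositional using (_∈_; find)
open import Data.List.Membership.Propositional.Properties
  using (∈-∃++; ∈-++⁻; ∈-++⁺ˡ; ∈-++⁺ʳ; ∈-map⁺; ∈-map⁻; ∈-concatMap⁺; ∈-concatMap⁻; ∈-allFin; ∈-filter⁺; ∈-filter⁻)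
open import Data.List.Membership.DecPropositional _≟_ using (_∈?_)
open import Data.List.Relation.Binary.Subset.Propositional using (_⊆_)
open import Data.List.Relation.Unary.Any using (here; there)
import Data.List.Relation.Unary.Any as Any
import Data.List.Relation.Unary.Any.Properties as Anyₚ
import Data.List.Relation.Unary.All as All
open import Data.List.Relation.Unary.Unique.Propositional using (Unique; _∷_)
open import Data.List.Relation.Unary.Unique.DecPropositional.Properties _≟_ using (deduplicate-!)
open import Data.Product using (∃; _×_; _,_; proj₁; proj₂)
open import Data.Sum using (_⊎_; inj₁; inj₂)
open import Relation.Nullary using (¬_; Dec; yes; no; contradiction)
open import Relation.Unary using (Decidable)
open import Relation.Binary.PropositionalEquality
  using (_≡_; _≢_; refl; sym; trans; cong; subst; ≢-sym; module ≡-Reasoning)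
open import Function using (_∘_)

∈-without : ∀ {A : Set} (as bs : List A) {v y : A} →
  v ∈ as ++ y ∷ bs → v ≢ y → v ∈ as ++ bs
∈-without as bs v∈ v≢y with ∈-++⁻ as v∈
... | inj₁ v∈as         = ∈-++⁺ˡ v∈as
... | inj₂ (here refl)  = contradiction refl v≢y
... | inj₂ (there v∈bs) = ∈-++⁺ʳ as v∈bs

unique-⊆-length : ∀ {A : Set} {xs ys : List A} → Unique xs → xs ⊆ ys → length xs ≤ length ys
unique-⊆-length {xs = []}     _              _   = z≤n
unique-⊆-length {xs = x ∷ xs} (x∉xs ∷ !xs) xs⊆ys with ∈-∃++ (xs⊆ys (here refl))
... | as , bs , refl = begin
  suc (length xs)          ≤⟨ s≤s (unique-⊆-length !xs rest⊆) ⟩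
  suc (length (as ++ bs))  ≡⟨ length-++-sucʳ as x bs ⟨
  length (as ++ x ∷ bs)    ∎
  where
  open ≤-Reasoning
  -- x occurs in ys only at the chosen position, so the rest of xs fits around it
  rest⊆ : xs ⊆ as ++ bs
  rest⊆ v∈xs = ∈-without as bs (xs⊆ys (there v∈xs)) (≢-sym (All.lookup x∉xs v∈xs))

∈-dedup⁺ : ∀ {v} {xs : List ℤ} → v ∈ xs → v ∈ deduplicate _≟_ xs
∈-dedup⁺ = Anyₚ.deduplicate⁺ _≟_ (λ { refl v∈ → v∈ })

∈-dedup⁻ : ∀ {v} {xs : List ℤ} → v ∈ deduplicate _≟_ xs → v ∈ xs
∈-dedup⁻ = Anyₚ.deduplicate⁻ _≟_

card-mono : ∀ {xs ys : List ℤ} → xs ⊆ ys → card xs ≤ card ys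
card-mono xs⊆ys = unique-⊆-length (deduplicate-! _) (∈-dedup⁺ ∘ xs⊆ys ∘ ∈-dedup⁻)

card-map-< : ∀ (g : ℤ → ℤ) {xs : List ℤ} {x y : ℤ} →
  x ∈ xs → y ∈ xs → x ≢ y → g x ≡ g y → card (map g xs) < card xs
card-map-< g {xs} {x} {y} x∈ y∈ x≢y gx≡gy with ∈-∃++ (∈-dedup⁺ {xs = xs} y∈)
... | as , bs , split = begin-strict
  card (map g xs)           ≤⟨ unique-⊆-length (deduplicate-! _) image⊆ ⟩
  length (map g (as ++ bs)) ≡⟨ length-map g (as ++ bs) ⟩
  length (as ++ bs)         <⟨ s≤s ≤-refl ⟩
  suc (length (as ++ bs))   ≡⟨ length-++-sucʳ as y bs ⟨
  length (as ++ y ∷ bs)     ≡⟨ cong length split ⟨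
  card xs                   ∎
  where
  open ≤-Reasoning
  -- each image point g v is hit by some v ≠ y: if v = y, take x instead
  image⊆ : deduplicate _≟_ (map g xs) ⊆ map g (as ++ bs)
  image⊆ w∈ with ∈-map⁻ g (∈-dedup⁻ w∈)
  ... | v , v∈xs , refl with v ≟ y
  ... | yes refl = subst (_∈ map g (as ++ bs)) gx≡gy
                     (∈-map⁺ g (∈-without as bs (subst (x ∈_) split (∈-dedup⁺ x∈)) x≢y))
  ... | no v≢y   = ∈-map⁺ g (∈-without as bs (subst (v ∈_) split (∈-dedup⁺ v∈xs)) v≢y)

∈-concatMap-at : ∀ {A : Set} (Y : A → List ℤ) {is : List A} {a : A} {v : ℤ} →
  a ∈ is → v ∈ Y a → v ∈ concatMap Y is
∈-concatMap-at Y a∈is v∈Ya = ∈-concatMap⁺ Y (Any.map (λ { refl → v∈Ya }) a∈is)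

∈-concatMap-inv : ∀ {A : Set} (Y : A → List ℤ) {is : List A} {v : ℤ} →
  v ∈ concatMap Y is → ∃ λ a → a ∈ is × v ∈ Y a
∈-concatMap-inv Y v∈ = find (∈-concatMap⁻ Y v∈)

∈-⋃⁺ : ∀ {n} (Y : Fin n → List ℤ) {a : Fin n} {v : ℤ} → v ∈ Y a → v ∈ ⋃ Y
∈-⋃⁺ Y {a} = ∈-concatMap-at Y (∈-allFin a)

∈-⋃⁻ : ∀ {n} (Y : Fin n → List ℤ) {v : ℤ} → v ∈ ⋃ Y → ∃ λ a → v ∈ Y a
∈-⋃⁻ {n} Y v∈ with ∈-concatMap-inv Y {allFin n} v∈
... | a , _ , v∈Ya = a , v∈Ya

⋃[_] : ∀ {n} {P : Fin n → Set} → Decidable P → (Fin n → List ℤ) → List ℤ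
⋃[_] {n} P? Y = concatMap Y (filter P? (allFin n))

∈-⋃[]⁺ : ∀ {n} {P : Fin n → Set} (P? : Decidable P) (Y : Fin n → List ℤ) {a : Fin n} {v : ℤ} →
  P a → v ∈ Y a → v ∈ ⋃[ P? ] Y
∈-⋃[]⁺ P? Y {a} Pa = ∈-concatMap-at Y (∈-filter⁺ P? (∈-allFin a) Pa)

∈-⋃[]⁻ : ∀ {n} {P : Fin n → Set} (P? : Decidable P) (Y : Fin n → List ℤ) {v : ℤ} →
  v ∈ ⋃[ P? ] Y → ∃ λ a → P a × v ∈ Y a
∈-⋃[]⁻ {n} P? Y v∈ with ∈-concatMap-inv Y {filter P? (allFin n)} v∈
... | a , a∈ , v∈Ya = a , proj₂ (∈-filter⁻ P? {xs = allFin n} a∈) , v∈Ya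

Separates : ∀ {n} → (Fin n → List ℤ) → (Fin n → Set) → Set
Separates Y P = ∀ {a a′ v} → P a → ¬ P a′ → v ∈ Y a → ¬ v ∈ Y a′

module Translate {n} (Y : Fin n → List ℤ) {P : Fin n → Set} (P? : Decidable P)
                 (separates : Separates Y P) (t : ℤ) where

  shift : Fin n → ℤ
  shift a with P? a
  ... | yes _ = 0ℤ
  ... | no _  = t

  shift-inside : ∀ {a} → P a → shift a ≡ 0ℤ
  shift-inside {a} Pa with P? a
  ... | yes _  = refl
  ... | no ¬Pa = contradiction Pa ¬Pa

  shift-outside : ∀ {a} → ¬ P a → shift a ≡ t
  shift-outside {a} ¬Pa with P? a
  ... | yes Pa = contradiction Pa ¬Pa
  ... | no _   = refl

  fold : ℤ → ℤ
  fold v with v ∈? ⋃[ P? ] Y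
  ... | yes _ = v
  ... | no _  = v + t

  fold-inside : ∀ {v} → v ∈ ⋃[ P? ] Y → fold v ≡ v
  fold-inside {v} v∈ with v ∈? ⋃[ P? ] Y
  ... | yes _  = refl
  ... | no v∉ = contradiction v∈ v∉

  fold-outside : ∀ {v} → ¬ v ∈ ⋃[ P? ] Y → fold v ≡ v + t
  fold-outside {v} v∉ with v ∈? ⋃[ P? ] Y
  ... | yes v∈ = contradiction v∈ v∉
  ... | no _   = refl

  outside-∉ : ∀ {a v} → ¬ P a → v ∈ Y a → ¬ v ∈ ⋃[ P? ] Y
  outside-∉ ¬Pa v∈Ya v∈ with ∈-⋃[]⁻ P? Y v∈
  ... | a′ , Pa′ , v∈Ya′ = separates Pa′ ¬Pa v∈Ya′ v∈Ya

  fold-agrees : ∀ {a v} → v ∈ Y a → v + shift a ≡ fold v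
  fold-agrees {a} {v} v∈Ya = by-side (P? a)
    where
    open ≡-Reasoning
    by-side : Dec (P a) → v + shift a ≡ fold v
    by-side (yes Pa) = begin
      v + shift a  ≡⟨ cong (v +_) (shift-inside Pa) ⟩
      v + 0ℤ       ≡⟨ +-identityʳ v ⟩
      v            ≡⟨ fold-inside (∈-⋃[]⁺ P? Y Pa v∈Ya) ⟨
      fold v       ∎
    by-side (no ¬Pa) = begin
      v + shift a  ≡⟨ cong (v +_) (shift-outside ¬Pa) ⟩
      v + t        ≡⟨ fold-outside (outside-∉ ¬Pa v∈Ya) ⟨
      fold v       ∎

  translated-⊆ : ⋃ (λ a → Y a ⊕ shift a) ⊆ map fold (⋃ Y)
  translated-⊆ w∈ with ∈-⋃⁻ (λ a → Y a ⊕ shift a) w∈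
  ... | a , w∈Ya⊕ with ∈-map⁻ (_+ shift a) w∈Ya⊕
  ... | v , v∈Ya , refl =
    subst (_∈ map fold (⋃ Y)) (sym (fold-agrees v∈Ya)) (∈-map⁺ fold (∈-⋃⁺ Y v∈Ya))

  translate-shrinks : ∀ {b c x y} → P b → ¬ P c → x ∈ Y b → y ∈ Y c → y + t ≡ x →
    card (⋃ (λ a → Y a ⊕ shift a)) < card (⋃ Y)
  translate-shrinks Pb ¬Pc x∈Yb y∈Yc y+t≡x =
    ≤-<-trans (card-mono translated-⊆)
              (card-map-< fold (∈-⋃⁺ Y x∈Yb) (∈-⋃⁺ Y y∈Yc) x≢y fold-x≡fold-y)
    where
    x≢y : _ ≢ _
    x≢y refl = separates Pb ¬Pc x∈Yb y∈Yc
    fold-x≡fold-y : fold _ ≡ fold _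
    fold-x≡fold-y = trans (fold-inside (∈-⋃[]⁺ P? Y Pb x∈Yb))
                          (sym (trans (fold-outside (outside-∉ ¬Pc y∈Yc)) y+t≡x))

-- In a disconnection (B, C) every vertex lies in exactly one side, so B is decidable.
side? : ∀ {n} {B C : Fin n → Set} →
  (∀ a → B a ⊎ C a) → (∀ a → B a → ¬ C a) → Decidable B
side? cover disjoint a with cover a
... | inj₁ Ba = yes Ba
... | inj₂ Ca = no (λ Ba → disjoint a Ba Ca)

no-edges-separate : ∀ {n} {Y : Fin n → List ℤ} {B C : Fin n → Set} →
  (∀ a → B a ⊎ C a) → (∀ b c → B b → C c → ¬ Edge Y b c) → Separates Y B
no-edges-separate cover noEdge {a′ = a′} Ba ¬Ba′ v∈Ya v∈Ya′ with cover a′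
... | inj₁ Ba′ = ¬Ba′ Ba′
... | inj₂ Ca′ = noEdge _ a′ Ba Ca′ ((λ { refl → ¬Ba′ Ba }) , _ , v∈Ya , v∈Ya′)

nonempty-member : ∀ {A : Set} (xs : List A) → xs ≢ [] → ∃ λ x → x ∈ xs
nonempty-member []       xs≢[] = contradiction refl xs≢[]
nonempty-member (x ∷ _) _     = x , here refl

+-difference : ∀ (x y : ℤ) → y + (x - y) ≡ x
+-difference = solve-∀

lemma1 : (n : ℕ) (Y : Fin n → List ℤ) →
    (∀ a → Y a ≢ []) →
    IntersectionGraphDisconnected Y →
    ∃ λ (u : Fin n → ℤ) → card (⋃ (λ a → Y a ⊕ u a)) < card (⋃ Y)
lemma1 n Y nonempty (B , C , (b , Bb) , (c , Cc) , disjoint , cover , noEdge) =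
  shift , translate-shrinks Bb (λ Bc → disjoint c Bc Cc) x∈Yb y∈Yc (+-difference x y)
  where
  x y : ℤ
  x = proj₁ (nonempty-member (Y b) (nonempty b))
  y = proj₁ (nonempty-member (Y c) (nonempty c))
  x∈Yb : x ∈ Y b
  x∈Yb = proj₂ (nonempty-member (Y b) (nonempty b))
  y∈Yc : y ∈ Y c
  y∈Yc = proj₂ (nonempty-member (Y c) (nonempty c))
  open Translate Y (side? cover disjoint) (no-edges-separate cover noEdge) (x - y)
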